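{- For every graph $H$, it holds that $c^*(H)-1\leq d^*(H)\leq c^*(H)$.
   Context: Graphs may have loops; $N(v)$ is the neighborhood of $v$; vertices $u,v$ are incomparable if neither $N(u)\subseteq N(v)$ nor $N(v)\subseteq N(u)$. A set $S$ has a common neighbor in $L$ if some vertex of $L$ is adjacent to all vertices of $S$. $c^*(H)$ is the maximum over $L\subseteq V(H)$ of the largest size of an inclusion-minimal $S\subseteq V(H)$ without a common neighbor in $L$. A lower bound structure of order $d$: a set $L\subseteq V(H)$, distinct $x_1,\dots,x_d$, not necessarily distinct $x_1',\dots,x_d'$ with $x_i,x_i'$ incomparable, $\bigcap_i N(x_i)\cap L=\emptyset$, and $\bigcap_i N(y_i)\cap L\ne\emptyset$ for every choice $y_i\in\{x_i,x_i'\}$ with at least one $y_i=x_i'$. $d^*(H)$ is the largest order of a lower bound structure in $H$. -}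

module Defs where

open import Data.Nat using (ℕ; _≤_)
open import Data.Bool using (Bool; true; false; if_then_else_)
open import Data.Fin using (Fin)
open import Data.Fin.Subset using (Subset; _∈_; _⊆_; ∣_∣)
open import Data.Vec using (tabulate)
open import Data.Product using (Σ; ∃; _×_)
open import Function.Definitions using (Injective)
open import Relation.Nullary using (¬_)
open import Relation.Binary.PropositionalEquality using (_≡_)

-- A finite (undirected) graph on vertex set Fin n; loops are allowed
-- (adj v v may be true).
record Graph : Set where
  field
    n   : ℕ
    adj : Fin n → Fin n → Bool
    sym : ∀ u v → adj u v ≡ adj v u

module _ (H : Graph) where
  open Graph H

  N : Fin n → Subset n
  N v = tabulate (λ u → adj v u)

  Incomparable : Fin n → Fin n → Set
  Incomparable u v = ¬ (N u ⊆ N v) × ¬ (N v ⊆ N u)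

  HasCommonNeighbor : Subset n → Subset n → Set
  HasCommonNeighbor L S = ∃ λ w → w ∈ L × (∀ s → s ∈ S → s ∈ N w)

  MinimalNoCN : Subset n → Subset n → Set
  MinimalNoCN L S =
    ¬ HasCommonNeighbor L S ×
    (∀ T → T ⊆ S → ¬ HasCommonNeighbor L T → T ≡ S)

  IsCStar : ℕ → Set
  IsCStar c =
    (Σ (Subset n) λ L → Σ (Subset n) λ S → MinimalNoCN L S × ∣ S ∣ ≡ c) ×
    (∀ L S → MinimalNoCN L S → ∣ S ∣ ≤ c)

  record LowerBoundStructure (d : ℕ) : Set where
    field
      L     : Subset n
      x     : Fin d → Fin n
      x'    : Fin d → Fin n
      x-inj : Injective _≡_ _≡_ x
      incomp : ∀ i → Incomparable (x i) (x' i)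
      empty : ¬ (∃ λ w → w ∈ L × (∀ i → w ∈ N (x i)))
      -- choice y_i = x'_i when b i = true, y_i = x_i otherwise
      nonempty : (b : Fin d → Bool) → (∃ λ i → b i ≡ true) →
        ∃ λ w → w ∈ L × (∀ i → w ∈ N (if b i then x' i else x i))

  IsDStar : ℕ → Set
  IsDStar d = LowerBoundStructure d × (∀ e → LowerBoundStructure e → e ≤ d)

-- Removing any vertex u from an inclusion-minimal set S without a common
-- neighbour in L creates a common neighbour w ∈ L, and w is not adjacent to u.
-- Hence distinct vertices of S have incomparable neighbourhoods, and after
-- fixing x₀ ∈ S the remaining c − 1 vertices, each paired with x₀, form a
-- lower bound structure over L ∩ N(x₀). Conversely the vertices x₁, …, x_d of
-- a lower bound structure form a minimal set: a subset T missing x_i has the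
-- common neighbour that exists for the choice y_i = x'_i, y_j = x_j (j ≠ i).
module Submission where

open import Defs
open import Data.Bool using (Bool; true; false; if_then_else_)
open import Data.Empty using (⊥-elim)
open import Data.Fin using (Fin; zero; suc; _≟_)
open import Data.Fin.Properties using (any?; all?; injective⇒≤; suc-injective)
open import Data.Fin.Subset using (Subset; _∈_; _∉_; _⊆_; ∣_∣; inside; outside; _∩_; _-_)
open import Data.Fin.Subset.Properties
  using (_∈?_; ⊆-antisym; ⊂-irref; x∈p∩q⁺; x∈p∩q⁻; p─q⊆p; x∈p∧x≢y⇒x∈p-y; x∈p⇒p-x⊂p)
open import Data.Nat using (ℕ; zero; suc; _≤_; _∸_; z≤n)
open import Data.Nat.Properties using (≤-trans)
open import Data.Product using (∃; _×_; _,_; proj₁; proj₂)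
open import Data.Vec using ([]; _∷_; here; there; tabulate)
open import Data.Vec.Properties using ([]=⇒lookup; lookup⇒[]=; lookup∘tabulate)
open import Function using (_∘_)
open import Function.Definitions using (Injective)
open import Relation.Nullary using (¬_; Dec; yes; no; does; contradiction)
open import Relation.Nullary.Decidable using (dec-true; _×-dec_; _→-dec_)
open import Relation.Binary.PropositionalEquality using (_≡_; _≢_; refl; sym; trans; cong; subst)

∈-tabulate⁺ : ∀ {n} (f : Fin n → Bool) {x} → f x ≡ true → x ∈ tabulate f
∈-tabulate⁺ f {x} fx≡true = lookup⇒[]= x (tabulate f) (trans (lookup∘tabulate f x) fx≡true)

∈-tabulate⁻ : ∀ {n} (f : Fin n → Bool) {x} → x ∈ tabulate f → f x ≡ true
∈-tabulate⁻ f {x} x∈ = trans (sym (lookup∘tabulate f x)) ([]=⇒lookup x∈)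

image : ∀ {d n} → (Fin d → Fin n) → Subset n
image f = tabulate λ v → does (any? λ i → f i ≟ v)

∈-image⁺ : ∀ {d n} (f : Fin d → Fin n) i → f i ∈ image f
∈-image⁺ f i = ∈-tabulate⁺ _ (dec-true (any? λ j → f j ≟ f i) (i , refl))

∈-image⁻ : ∀ {d n} (f : Fin d → Fin n) {v} → v ∈ image f → ∃ λ i → f i ≡ v
∈-image⁻ f {v} v∈ with any? (λ i → f i ≟ v) | ∈-tabulate⁻ _ v∈
... | yes found | _  = found
... | no _      | ()

record Enumeration {n} (p : Subset n) (m : ℕ) : Set where
  field
    index     : Fin m → Fin n
    injective : Injective _≡_ _≡_ index
    index∈p   : ∀ i → index i ∈ p
    onto      : ∀ {v} → v ∈ p → ∃ λ i → index i ≡ v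

enumerate : ∀ {n} (p : Subset n) → Enumeration p ∣ p ∣
enumerate [] = record { index = λ () ; injective = λ { {()} } ; index∈p = λ () ; onto = λ () }
enumerate (outside ∷ p) = record
  { index     = suc ∘ index
  ; injective = injective ∘ suc-injective
  ; index∈p   = there ∘ index∈p
  ; onto      = λ { (there v∈p) → let i , eq = onto v∈p in i , cong suc eq }
  }
  where open Enumeration (enumerate p)
enumerate (inside ∷ p) = record
  { index = index′ ; injective = injective′ ; index∈p = index′∈ ; onto = onto′ }
  where
  open Enumeration (enumerate p)
  index′ : Fin (suc ∣ p ∣) → Fin _
  index′ zero    = zero
  index′ (suc i) = suc (index i)
  injective′ : Injective _≡_ _≡_ index′
  injective′ {zero}  {zero}  _  = refl
  injective′ {suc i} {suc j} eq = cong suc (injective (suc-injective eq))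
  index′∈ : ∀ i → index′ i ∈ inside ∷ p
  index′∈ zero    = here
  index′∈ (suc i) = there (index∈p i)
  onto′ : ∀ {v} → v ∈ inside ∷ p → ∃ λ i → index′ i ≡ v
  onto′ here        = zero , refl
  onto′ (there v∈p) = let i , eq = onto v∈p in suc i , cong suc eq

injection-into⇒≤∣p∣ : ∀ {d n} (p : Subset n) {f : Fin d → Fin n} →
  Injective _≡_ _≡_ f → (∀ i → f i ∈ p) → d ≤ ∣ p ∣
injection-into⇒≤∣p∣ p {f} f-injective f∈p = injective⇒≤ {f = position} position-injective
  where
  open Enumeration (enumerate p)
  position : _ → Fin ∣ p ∣
  position i = proj₁ (onto (f∈p i))
  position-injective : Injective _≡_ _≡_ position
  position-injective {i} {j} eq =
    f-injective (trans (sym (proj₂ (onto (f∈p i)))) (trans (cong index eq) (proj₂ (onto (f∈p j)))))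

module _ (H : Graph) where
  open Graph H using (n; adj)

  IsCommonNeighbour : Fin n → Subset n → Set
  IsCommonNeighbour w S = ∀ s → s ∈ S → s ∈ N H w

  ∈N-sym : ∀ {u v} → u ∈ N H v → v ∈ N H u
  ∈N-sym {u} {v} u∈ = ∈-tabulate⁺ (adj u) (trans (Graph.sym H u v) (∈-tabulate⁻ (adj v) u∈))

  hasCommonNeighbour? : ∀ L S → Dec (HasCommonNeighbor H L S)
  hasCommonNeighbour? L S = any? λ w → (w ∈? L) ×-dec all? λ s → (s ∈? S) →-dec (s ∈? N H w)

  module _ {L S : Subset n} (minimal : MinimalNoCN H L S) where

    minimal-drop-hasCN : ∀ {u} → u ∈ S → HasCommonNeighbor H L (S - u)
    minimal-drop-hasCN {u} u∈S with hasCommonNeighbour? L (S - u)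
    ... | yes hasCN = hasCN
    ... | no ¬hasCN = ⊥-elim (⊂-irref (proj₂ minimal (S - u) (p─q⊆p S _) ¬hasCN) (x∈p⇒p-x⊂p u∈S))

    commonNeighbour-of-drop-∉N : ∀ {u w} → w ∈ L → IsCommonNeighbour w (S - u) → u ∉ N H w
    commonNeighbour-of-drop-∉N {u} {w} w∈L cn u∈Nw = proj₁ minimal (w , w∈L , cn′)
      where
      cn′ : IsCommonNeighbour w S
      cn′ s s∈S with s ≟ u
      ... | yes refl = u∈Nw
      ... | no s≢u   = cn s (x∈p∧x≢y⇒x∈p-y s∈S s≢u)

    minimal-N⊈ : ∀ {u v} → u ∈ S → v ∈ S → u ≢ v → ¬ (N H u ⊆ N H v)
    minimal-N⊈ u∈S v∈S u≢v Nu⊆Nv with minimal-drop-hasCN v∈S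
    ... | w , w∈L , cn = commonNeighbour-of-drop-∉N w∈L cn
                           (∈N-sym (Nu⊆Nv (∈N-sym (cn _ (x∈p∧x≢y⇒x∈p-y u∈S u≢v)))))

    minimal⇒incomparable : ∀ {u v} → u ∈ S → v ∈ S → u ≢ v → Incomparable H u v
    minimal⇒incomparable u∈S v∈S u≢v = minimal-N⊈ u∈S v∈S u≢v , minimal-N⊈ v∈S u∈S (u≢v ∘ sym)

    minimal⇒lowerBoundStructure : ∀ {m} → Enumeration S (suc m) → LowerBoundStructure H m
    minimal⇒lowerBoundStructure {m} enum = record
      { L = L ∩ N H x₀ ; x = x ; x' = λ _ → x₀ ; x-inj = suc-injective ∘ injective
      ; incomp = λ i → minimal⇒incomparable (index∈p (suc i)) (index∈p zero) (distinct λ ())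
      ; empty = empty ; nonempty = nonempty }
      where
      open Enumeration enum
      x₀ = index zero
      x : Fin m → Fin n
      x = index ∘ suc
      distinct : ∀ {j k} → j ≢ k → index j ≢ index k
      distinct j≢k = j≢k ∘ injective
      empty : ¬ (∃ λ w → w ∈ L ∩ N H x₀ × (∀ i → w ∈ N H (x i)))
      empty (w , w∈L∩Nx₀ , w∈Nx) = proj₁ minimal (w , w∈L , cn)
        where
        w∈L = proj₁ (x∈p∩q⁻ L _ w∈L∩Nx₀)
        cn : IsCommonNeighbour w S
        cn s s∈S with onto s∈S
        ... | zero  , refl = ∈N-sym (proj₂ (x∈p∩q⁻ L _ w∈L∩Nx₀))
        ... | suc i , refl = ∈N-sym (w∈Nx i)
      nonempty : (b : Fin m → Bool) → (∃ λ i → b i ≡ true) →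
        ∃ λ w → w ∈ L ∩ N H x₀ × (∀ j → w ∈ N H (if b j then x₀ else x j))
      nonempty b (i , bi≡true) with minimal-drop-hasCN (index∈p (suc i))
      ... | w , w∈L , cn = w , x∈p∩q⁺ (w∈L , w∈N zero λ ()) , w∈Ny
        where
        w∈N : ∀ j → j ≢ suc i → w ∈ N H (index j)
        w∈N j j≢ = ∈N-sym (cn _ (x∈p∧x≢y⇒x∈p-y (index∈p j) (distinct j≢)))
        w∈Ny : ∀ j → w ∈ N H (if b j then x₀ else x j)
        w∈Ny j with j ≟ i
        ... | yes refl rewrite bi≡true = w∈N zero λ ()
        ... | no j≢i with b j
        ...   | true  = w∈N zero λ ()
        ...   | false = w∈N (suc j) (j≢i ∘ suc-injective)

  module _ {d} (lb : LowerBoundStructure H d) where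
    open LowerBoundStructure lb

    avoiding-hasCN : ∀ {T} i → T ⊆ image x → x i ∉ T → HasCommonNeighbor H L T
    avoiding-hasCN {T} i T⊆S xi∉T with nonempty (λ j → does (j ≟ i)) (i , dec-true (i ≟ i) refl)
    ... | w , w∈L , w∈Ny = w , w∈L , cn
      where
      cn : IsCommonNeighbour w T
      cn t t∈T with ∈-image⁻ x (T⊆S t∈T)
      ... | j , refl with j ≟ i | w∈Ny j
      ...   | yes refl | _   = contradiction t∈T xi∉T
      ...   | no _     | w∈N = ∈N-sym w∈N

    lowerBoundStructure⇒minimal : MinimalNoCN H L (image x)
    lowerBoundStructure⇒minimal = noCN , minimality
      where
      noCN : ¬ HasCommonNeighbor H L (image x)
      noCN (w , w∈L , cn) = empty (w , w∈L , λ i → ∈N-sym (cn _ (∈-image⁺ x i)))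
      minimality : ∀ T → T ⊆ image x → ¬ HasCommonNeighbor H L T → T ≡ image x
      minimality T T⊆S ¬hasCN = ⊆-antisym T⊆S S⊆T
        where
        S⊆T : image x ⊆ T
        S⊆T v∈S with ∈-image⁻ x v∈S
        ... | i , refl with x i ∈? T
        ...   | yes xi∈T = xi∈T
        ...   | no xi∉T  = ⊥-elim (¬hasCN (avoiding-hasCN i T⊆S xi∉T))

    order≤∣image∣ : d ≤ ∣ image x ∣
    order≤∣image∣ = injection-into⇒≤∣p∣ (image x) x-inj (∈-image⁺ x)

lemma12 : (H : Graph) (c d : ℕ) → IsCStar H c → IsDStar H d →
    (c ∸ 1 ≤ d) × (d ≤ c)
lemma12 H c d ((L , S , minimal , ∣S∣≡c) , c-max) (lb , d-max) = lower c ∣S∣≡c , upper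
  where
  lower : ∀ c → ∣ S ∣ ≡ c → c ∸ 1 ≤ d
  lower zero    _          = z≤n
  lower (suc m) ∣S∣≡1+m = d-max m (minimal⇒lowerBoundStructure H minimal
                                     (subst (Enumeration S) ∣S∣≡1+m (enumerate S)))
  upper : d ≤ c
  upper = ≤-trans (order≤∣image∣ H lb) (c-max _ _ (lowerBoundStructure⇒minimal H lb))
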